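{- Let $p\neq 3$ be a prime. If $p$ possesses no compression points or only finitely many compression points, then there is an $\epsilon>0$ such that for all integers $n>0$, $\|p^n\|_{\log} \geq 3+\epsilon$.
   Context: For a positive integer $m$, $\|m\|$ denotes the minimum number of occurrences of the constant $1$ in an arithmetic expression built only from the constant $1$, addition, multiplication and parentheses whose value is $m$; for $m>1$, $\|m\|_{\log} = \|m\|/\log_3 m$. For a prime $p$, a positive integer $n$ is called a compression point for powers of $p$ if for every finite sequence of integers $k_i$ with $0<k_i<n$ and $\sum k_i = n$ one has $\|p^n\| < \sum \|p^{k_i}\|$. -}

module Defs where

open import Data.Nat using (ℕ; _+_; _*_; _^_; _≤_; _<_)
open import Data.List using (List)
open import Data.Nat.ListAction using (sum)
open import Data.List.Relation.Unary.All using (All)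
open import Data.List.Relation.Binary.Pointwise using (Pointwise)
open import Data.Product using (Σ; _×_; ∃-syntax)
open import Relation.Binary.PropositionalEquality using (_≡_)

data Expr : Set where
  one : Expr
  _⊕_ : Expr → Expr → Expr
  _⊗_ : Expr → Expr → Expr

eval : Expr → ℕ
eval one = 1
eval (e ⊕ f) = eval e + eval f
eval (e ⊗ f) = eval e * eval f

ones : Expr → ℕ
ones one = 1
ones (e ⊕ f) = ones e + ones f
ones (e ⊗ f) = ones e + ones f

-- Complexity m c  :⇔  ‖m‖ = c, i.e. c is the minimum number of 1's over
-- all expressions evaluating to m (attained and a lower bound).
Complexity : ℕ → ℕ → Set
Complexity m c =
  (∃[ e ] (eval e ≡ m × ones e ≡ c)) × (∀ e → eval e ≡ m → c ≤ ones e)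

CompressionPoint : ℕ → ℕ → Set
CompressionPoint p n =
  0 < n ×
  ((ks : List ℕ) → All (λ k → 0 < k × k < n) ks → sum ks ≡ n →
   (c : ℕ) → Complexity (p ^ n) c →
   (cs : List ℕ) → Pointwise (λ k ck → Complexity (p ^ k) ck) ks cs →
   c < sum cs)

-- Every expression satisfies ‖m‖ ≥ 3 log₃ m, because eval e ^ 3 ≤ 3 ^ ones e is preserved by
-- sums and products.  For a prime p ≠ 3 and k > 0 the cube (p^k)^3 is never a power of 3, so
-- the inequality is strict, and Bernoulli's inequality turns the strict gap into a uniform
-- margin ε = 1/(p^N)^4 for all exponents k ≤ N.  The bound m^(3b+a) ≤ 3^(bc) is multiplicative
-- in m and additive in c, so it passes from exponents k_i to their sum n whenever n is not a
-- compression point, i.e. whenever ‖p^n‖ ≥ Σ ‖p^(k_i)‖ for some splitting n = Σ k_i; beyond the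
-- last compression point N strong induction therefore carries the margin to every n.
module Submission where

open import Defs
open import Data.Nat using (ℕ; zero; suc; _+_; _*_; _^_; _≤_; _<_; _≤?_; z≤n; s≤s; nonTrivial⇒n>1)
open import Data.Nat.Properties
open import Data.Nat.Divisibility using (_∣_; ∣-refl; ∣1⇒≡1; ∣m⇒∣m*n)
open import Data.Nat.Induction using (<-rec)
open import Data.Nat.ListAction using (sum)
open import Data.Nat.Primality
  using (Prime; prime?; euclidsLemma; prime⇒irreducible; prime⇒nonZero; prime⇒nonTrivial)
open import Data.Nat.Tactic.RingSolver using (solve-∀)
open import Data.List using (List; []; _∷_)
open import Data.List.Relation.Unary.All using (All; []; _∷_)
open import Data.List.Relation.Binary.Pointwise using (Pointwise; []; _∷_)
open import Data.Product using (_×_; _,_; ∃-syntax)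
open import Data.Sum using (inj₁; inj₂)
open import Relation.Nullary using (¬_; yes; no; contradiction)
open import Relation.Nullary.Decidable using (from-yes)
open import Relation.Binary.PropositionalEquality
  using (_≡_; _≢_; refl; sym; cong; subst; subst₂; module ≡-Reasoning)

^-distribʳ-* : ∀ m n k → (m * n) ^ k ≡ m ^ k * n ^ k
^-distribʳ-* m n zero    = refl
^-distribʳ-* m n (suc k) = begin
  m * n * (m * n) ^ k       ≡⟨ cong (m * n *_) (^-distribʳ-* m n k) ⟩
  m * n * (m ^ k * n ^ k)   ≡⟨ [m*n]*[o*p]≡[m*o]*[n*p] m n (m ^ k) (n ^ k) ⟩
  m * m ^ k * (n * n ^ k)   ∎
  where open ≡-Reasoning

m+n≤m*n : ∀ {m n} → 2 ≤ m → 2 ≤ n → m + n ≤ m * n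
m+n≤m*n {suc (suc s)} {suc (suc t)} (s≤s (s≤s _)) (s≤s (s≤s _)) =
  subst (2 + s + (2 + t) ≤_) (sym (expand s t)) (m≤m+n _ _)
  where
  expand : ∀ s t → (2 + s) * (2 + t) ≡ (2 + s + (2 + t)) + (s + t + s * t)
  expand = solve-∀

[1+n]³≤3*n³ : ∀ {n} → 3 ≤ n → (1 + n) ^ 3 ≤ 3 * n ^ 3
[1+n]³≤3*n³ {suc (suc (suc t))} (s≤s (s≤s (s≤s _))) =
  subst ((4 + t) ^ 3 ≤_) (sym (expand t)) (m≤m+n _ _)
  where
  -- the cubes are spelled out because the ring solver does not unfold _^_
  expand : ∀ t → 3 * ((3 + t) * ((3 + t) * ((3 + t) * 1)))
               ≡ (4 + t) * ((4 + t) * ((4 + t) * 1)) + (17 + 33 * t + 15 * (t * t) + 2 * (t * t * t))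
  expand = solve-∀

-- (1 + 1/x)^b ≥ 1 + b/x, cleared of denominators.
bernoulli : ∀ x b → x ^ b * (x + b) ≤ suc x ^ b * x
bernoulli x zero    = ≤-reflexive (+-identityʳ (x + 0))
bernoulli x (suc b) = begin
  x * x ^ b * (x + suc b)        ≡⟨ reassoc x (x ^ b) b ⟩
  x ^ b * (x * (x + suc b))      ≤⟨ *-monoʳ-≤ (x ^ b) (m≤m+n _ b) ⟩
  x ^ b * (x * (x + suc b) + b)  ≡⟨ cong (x ^ b *_) (expand x b) ⟩
  x ^ b * ((x + b) * suc x)      ≡⟨ sym (*-assoc (x ^ b) (x + b) (suc x)) ⟩
  x ^ b * (x + b) * suc x        ≤⟨ *-monoˡ-≤ (suc x) (bernoulli x b) ⟩
  suc x ^ b * x * suc x          ≡⟨ rotate (suc x ^ b) x ⟩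
  suc x * suc x ^ b * x          ∎
  where
  open ≤-Reasoning
  reassoc : ∀ x y b → x * y * (x + suc b) ≡ y * (x * (x + suc b))
  reassoc = solve-∀
  expand : ∀ x b → x * (x + suc b) + b ≡ (x + b) * suc x
  expand = solve-∀
  rotate : ∀ z x → z * x * suc x ≡ suc x * z * x
  rotate = solve-∀

x<X⇒m*x^b≤X^b : ∀ {m x b X} → 0 < x → x < X → m * x ≤ b → m * x ^ b ≤ X ^ b
x<X⇒m*x^b≤X^b {m} {x@(suc _)} {b} {X} _ x<X m*x≤b = *-cancelʳ-≤ (m * x ^ b) (X ^ b) x (begin
  m * x ^ b * x     ≡⟨ rearrange m (x ^ b) x ⟩
  x ^ b * (m * x)   ≤⟨ *-monoʳ-≤ (x ^ b) (≤-trans m*x≤b (m≤n+m b x)) ⟩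
  x ^ b * (x + b)   ≤⟨ bernoulli x b ⟩
  suc x ^ b * x     ≤⟨ *-monoˡ-≤ x (^-monoˡ-≤ b x<X) ⟩
  X ^ b * x         ∎)
  where
  open ≤-Reasoning
  rearrange : ∀ m y x → m * y * x ≡ y * (m * x)
  rearrange = solve-∀

3≤3^ : ∀ {a} → 1 ≤ a → 3 ≤ 3 ^ a
3≤3^ = ^-monoʳ-≤ 3

[1+y]³≤3^[1+b] : ∀ {y b} → 1 ≤ y → 1 ≤ b → y ^ 3 ≤ 3 ^ b → (1 + y) ^ 3 ≤ 3 ^ suc b
[1+y]³≤3^[1+b] {1} _ 1≤b _ = ≤-trans (n≤1+n 8) (*-monoʳ-≤ 3 (3≤3^ 1≤b))
[1+y]³≤3^[1+b] {2} {1} _ _ (s≤s (s≤s (s≤s ())))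
[1+y]³≤3^[1+b] {2} {suc (suc b)} _ _ _ = *-monoʳ-≤ 3 (*-monoʳ-≤ 3 (3≤3^ {suc b} (s≤s z≤n)))
[1+y]³≤3^[1+b] {y@(suc (suc (suc _)))} _ _ y³≤3^b =
  ≤-trans ([1+n]³≤3*n³ {y} (s≤s (s≤s (s≤s z≤n)))) (*-monoʳ-≤ 3 y³≤3^b)

[x+y]³≤3^[a+b] : ∀ {x y a b} → 1 ≤ x → 1 ≤ y → 1 ≤ a → 1 ≤ b →
                 x ^ 3 ≤ 3 ^ a → y ^ 3 ≤ 3 ^ b → (x + y) ^ 3 ≤ 3 ^ (a + b)
[x+y]³≤3^[a+b] {1} {y} {a} {b} _ 1≤y 1≤a 1≤b _ y³≤3^b =
  ≤-trans ([1+y]³≤3^[1+b] 1≤y 1≤b y³≤3^b) (^-monoʳ-≤ 3 (+-monoˡ-≤ b 1≤a))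
[x+y]³≤3^[a+b] {x@(suc (suc _))} {1} {a} {b} 1≤x _ 1≤a 1≤b x³≤3^a _ =
  subst₂ (λ u v → u ^ 3 ≤ 3 ^ v) (+-comm 1 x) (+-comm b a)
    (≤-trans ([1+y]³≤3^[1+b] 1≤x 1≤a x³≤3^a) (^-monoʳ-≤ 3 (+-monoˡ-≤ a 1≤b)))
[x+y]³≤3^[a+b] {x@(suc (suc _))} {y@(suc (suc _))} {a} {b} _ _ _ _ x³≤3^a y³≤3^b = begin
  (x + y) ^ 3      ≤⟨ ^-monoˡ-≤ 3 (m+n≤m*n {x} {y} (s≤s (s≤s z≤n)) (s≤s (s≤s z≤n))) ⟩
  (x * y) ^ 3      ≡⟨ ^-distribʳ-* x y 3 ⟩
  x ^ 3 * y ^ 3    ≤⟨ *-mono-≤ x³≤3^a y³≤3^b ⟩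
  3 ^ a * 3 ^ b    ≡⟨ ^-distribˡ-+-* 3 a b ⟨
  3 ^ (a + b)      ∎
  where open ≤-Reasoning

eval-positive : ∀ e → 1 ≤ eval e
eval-positive one     = ≤-refl
eval-positive (e ⊕ f) = ≤-trans (eval-positive e) (m≤m+n _ _)
eval-positive (e ⊗ f) = *-mono-≤ (eval-positive e) (eval-positive f)

ones-positive : ∀ e → 1 ≤ ones e
ones-positive one     = ≤-refl
ones-positive (e ⊕ f) = ≤-trans (ones-positive e) (m≤m+n _ _)
ones-positive (e ⊗ f) = ≤-trans (ones-positive e) (m≤m+n _ _)

eval³≤3^ones : ∀ e → eval e ^ 3 ≤ 3 ^ ones e
eval³≤3^ones one     = s≤s z≤n
eval³≤3^ones (e ⊕ f) =
  [x+y]³≤3^[a+b] (eval-positive e) (eval-positive f) (ones-positive e) (ones-positive f)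
                 (eval³≤3^ones e) (eval³≤3^ones f)
eval³≤3^ones (e ⊗ f) = begin
  (eval e * eval f) ^ 3        ≡⟨ ^-distribʳ-* (eval e) (eval f) 3 ⟩
  eval e ^ 3 * eval f ^ 3      ≤⟨ *-mono-≤ (eval³≤3^ones e) (eval³≤3^ones f) ⟩
  3 ^ ones e * 3 ^ ones f      ≡⟨ ^-distribˡ-+-* 3 (ones e) (ones f) ⟨
  3 ^ (ones e + ones f)        ∎
  where open ≤-Reasoning

Complexity⇒³≤3^ : ∀ {m c} → Complexity m c → m ^ 3 ≤ 3 ^ c
Complexity⇒³≤3^ ((e , refl , refl) , _) = eval³≤3^ones e

Complexity-unique : ∀ {m c d} → Complexity m c → Complexity m d → c ≡ d
Complexity-unique ((e , eval-e , refl) , minimal-c) ((f , eval-f , refl) , minimal-d) =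
  ≤-antisym (minimal-c f eval-f) (minimal-d e eval-e)

prime∣3^n⇒≡3 : ∀ {p} n → Prime p → p ∣ 3 ^ n → p ≡ 3
prime∣3^n⇒≡3 zero    p-prime p∣1 =
  contradiction (∣1⇒≡1 p∣1) (>⇒≢ (nonTrivial⇒n>1 _ {{prime⇒nonTrivial p-prime}}))
prime∣3^n⇒≡3 (suc n) p-prime p∣3*3^n with euclidsLemma 3 (3 ^ n) p-prime p∣3*3^n
... | inj₂ p∣3^n = prime∣3^n⇒≡3 n p-prime p∣3^n
... | inj₁ p∣3 with prime⇒irreducible (from-yes (prime? 3)) p∣3
...   | inj₁ refl = contradiction p-prime (λ ())
...   | inj₂ p≡3  = p≡3

-- For c = ‖m‖ this says ‖m‖_log ≥ 3 + a/b.
LogBound : (a b m c : ℕ) → Set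
LogBound a b m c = m ^ (3 * b + a) ≤ 3 ^ (b * c)

LogBound-* : ∀ {a b m n c d} → LogBound a b m c → LogBound a b n d → LogBound a b (m * n) (c + d)
LogBound-* {a} {b} {m} {n} {c} {d} m-bound n-bound = begin
  (m * n) ^ (3 * b + a)                  ≡⟨ ^-distribʳ-* m n (3 * b + a) ⟩
  m ^ (3 * b + a) * n ^ (3 * b + a)      ≤⟨ *-mono-≤ m-bound n-bound ⟩
  3 ^ (b * c) * 3 ^ (b * d)              ≡⟨ ^-distribˡ-+-* 3 (b * c) (b * d) ⟨
  3 ^ (b * c + b * d)                    ≡⟨ cong (3 ^_) (*-distribˡ-+ b c d) ⟨
  3 ^ (b * (c + d))                      ∎
  where open ≤-Reasoning

LogBound-monoʳ : ∀ {a b m c d} → c ≤ d → LogBound a b m c → LogBound a b m d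
LogBound-monoʳ {b = b} c≤d bound = ≤-trans bound (^-monoʳ-≤ 3 (*-monoʳ-≤ b c≤d))

LogBound-sum : ∀ {a b p ks cs} → Pointwise (λ k c → LogBound a b (p ^ k) c) ks cs →
               LogBound a b (p ^ sum ks) (sum cs)
LogBound-sum {a} {b} [] =
  subst₂ _≤_ (sym (^-zeroˡ (3 * b + a))) (cong (3 ^_) (sym (*-zeroʳ b))) ≤-refl
LogBound-sum {a} {b} {p} {k ∷ ks} (bound ∷ bounds) =
  subst (λ m → LogBound a b m _) (sym (^-distribˡ-+-* p k (sum ks)))
    (LogBound-* {a} {b} bound (LogBound-sum {a} {b} bounds))

cube<⇒LogBound : ∀ {m c b} → m ^ 3 < 3 ^ c → m ^ 4 ≤ b → LogBound 1 b m c
cube<⇒LogBound {zero} {c} {b} _ _ = subst (λ e → 0 ^ e ≤ 3 ^ (b * c)) (+-comm 1 (3 * b)) z≤n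
cube<⇒LogBound {m@(suc _)} {c} {b} m³<3^c m⁴≤b = begin
  m ^ (3 * b + 1)    ≡⟨ cong (m ^_) (+-comm (3 * b) 1) ⟩
  m * m ^ (3 * b)    ≡⟨ cong (m *_) (^-*-assoc m 3 b) ⟨
  m * (m ^ 3) ^ b    ≤⟨ x<X⇒m*x^b≤X^b {m} (m^n>0 m 3) m³<3^c m⁴≤b ⟩
  (3 ^ c) ^ b        ≡⟨ ^-*-assoc 3 c b ⟩
  3 ^ (c * b)        ≡⟨ cong (3 ^_) (*-comm c b) ⟩
  3 ^ (b * c)        ∎
  where open ≤-Reasoning

LogBoundedPower : (a b p n : ℕ) → Set
LogBoundedPower a b p n = ∀ c → Complexity (p ^ n) c → LogBound a b (p ^ n) c

¬LogBound⇒CompressionPoint : ∀ {a b p n c} → 0 < n →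
  (∀ {k} → k < n → 0 < k → LogBoundedPower a b p k) →
  Complexity (p ^ n) c → ¬ LogBound a b (p ^ n) c → CompressionPoint p n
¬LogBound⇒CompressionPoint {a} {b} {p} {n} {c} 0<n below complexity ¬bound = 0<n , compresses
  where
  bounds : ∀ {ks cs} → All (λ k → 0 < k × k < n) ks →
           Pointwise (λ k ck → Complexity (p ^ k) ck) ks cs →
           Pointwise (λ k ck → LogBound a b (p ^ k) ck) ks cs
  bounds [] [] = []
  bounds ((0<k , k<n) ∷ in-range) (complexity-k ∷ complexities) =
    below k<n 0<k _ complexity-k ∷ bounds in-range complexities

  compresses : (ks : List ℕ) → All (λ k → 0 < k × k < n) ks → sum ks ≡ n →
               (c′ : ℕ) → Complexity (p ^ n) c′ →
               (cs : List ℕ) → Pointwise (λ k ck → Complexity (p ^ k) ck) ks cs → c′ < sum cs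
  compresses ks in-range sum≡n c′ complexity′ cs complexities = ≰⇒> λ sum-cs≤c′ →
    ¬bound (LogBound-monoʳ {a} {b} (subst (sum cs ≤_) (Complexity-unique complexity′ complexity) sum-cs≤c′)
                                    (subst (λ k → LogBound a b (p ^ k) (sum cs)) sum≡n split-bound))
    where
    split-bound : LogBound a b (p ^ sum ks) (sum cs)
    split-bound = LogBound-sum {a} {b} (bounds in-range complexities)

LogBoundedPower-beyondCompressionPoints : ∀ {a b p} N → (∀ n → CompressionPoint p n → n ≤ N) →
  (∀ {k} → 0 < k → k ≤ N → LogBoundedPower a b p k) → ∀ n → 0 < n → LogBoundedPower a b p n
LogBoundedPower-beyondCompressionPoints {a} {b} {p} N compression≤N small = <-rec _ step
  where
  step : ∀ n → (∀ {k} → k < n → 0 < k → LogBoundedPower a b p k) → 0 < n → LogBoundedPower a b p n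
  step n below 0<n c complexity with n ≤? N
  ... | yes n≤N = small 0<n n≤N c complexity
  ... | no n≰N with (p ^ n) ^ (3 * b + a) ≤? 3 ^ (b * c)
  ...   | yes bound = bound
  ...   | no ¬bound =
    contradiction (compression≤N n (¬LogBound⇒CompressionPoint {a} {b} 0<n below complexity ¬bound)) n≰N

primePower-LogBound : ∀ {p N k} → Prime p → p ≢ 3 → 0 < k → k ≤ N →
                      LogBoundedPower 1 ((p ^ N) ^ 4) p k
primePower-LogBound {p} {N} {k@(suc k′)} p-prime p≢3 _ k≤N c complexity =
  cube<⇒LogBound (≤∧≢⇒< (Complexity⇒³≤3^ complexity) cube≢3^c) (^-monoˡ-≤ 4 (^-monoʳ-≤ p k≤N))
  where
  instance _ = prime⇒nonZero p-prime
  p∣cube : p ∣ (p ^ k) ^ 3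
  p∣cube = ∣m⇒∣m*n _ (∣m⇒∣m*n (p ^ k′) ∣-refl)
  cube≢3^c : (p ^ k) ^ 3 ≢ 3 ^ c
  cube≢3^c cube≡3^c = p≢3 (prime∣3^n⇒≡3 c p-prime (subst (p ∣_) cube≡3^c p∣cube))

proposition2 : (p : ℕ) → Prime p → p ≢ 3 →
    (∃[ N ] ((n : ℕ) → CompressionPoint p n → n ≤ N)) →
    ∃[ a ] ∃[ b ] (0 < a × 0 < b ×
      ((n : ℕ) → 0 < n → (c : ℕ) → Complexity (p ^ n) c →
        (p ^ n) ^ (3 * b + a) ≤ 3 ^ (b * c)))
proposition2 p p-prime p≢3 (N , compression≤N) =
  1 , (p ^ N) ^ 4 , s≤s z≤n , m^n>0 (p ^ N) {{m^n≢0 p N}} 4 ,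
  LogBoundedPower-beyondCompressionPoints {1} {(p ^ N) ^ 4} N compression≤N (primePower-LogBound p-prime p≢3)
  where instance _ = prime⇒nonZero p-prime
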